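{- Let $G$ be a nontrivial connected graph of order $n$ with $rvc(G)=k$. Let $G'$ be the graph obtained from $G$ by adding a new vertex $v$ and joining $v$ by edges to exactly $q$ vertices of $G$. If $q\geq n-k$, then $rvc(G')\leq k$.
   Context: All graphs are finite, simple and undirected. A vertex-coloring of a graph (not necessarily proper) makes the graph rainbow vertex-connected if every pair of distinct vertices is joined by a path whose internal vertices have pairwise distinct colors. For a connected graph $G$, the rainbow vertex-connection number $rvc(G)$ is the minimum number of colors in a vertex-coloring making $G$ rainbow vertex-connected (so $rvc(G)=0$ exactly when $G$ is complete). -}

module Defs where

open import Data.Nat using (ℕ; zero; suc; _<_)
open import Data.Unit using (⊤)
open import Data.Bool using (Bool; true; false; T)
open import Data.Fin using (Fin; zero; suc)
open import Data.Fin.Subset using (Subset)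
open import Data.Vec using (lookup)
open import Data.List using (List; []; _∷_; _++_; map)
open import Data.List.Relation.Unary.Unique.Propositional using (Unique)
open import Data.Product using (Σ; ∃; _×_; _,_)
open import Relation.Binary.PropositionalEquality using (_≡_)
open import Relation.Nullary using (¬_)

record Graph (n : ℕ) : Set where
  field
    adj   : Fin n → Fin n → Bool
    sym   : ∀ x y → adj x y ≡ adj y x
    irrfl : ∀ x → adj x x ≡ false
open Graph public

Chain : ∀ {n} → Graph n → List (Fin n) → Set
Chain G []           = ⊤
Chain G (x ∷ [])     = ⊤
Chain G (x ∷ y ∷ xs) = T (adj G x y) × Chain G (y ∷ xs)

IsPath : ∀ {n} → Graph n → Fin n → Fin n → List (Fin n) → Set
IsPath G u v int = Chain G (u ∷ int ++ v ∷ []) × Unique (u ∷ int ++ v ∷ [])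

Connected : ∀ {n} → Graph n → Set
Connected {n} G = ∀ (u v : Fin n) → ¬ (u ≡ v) → ∃ λ int → IsPath G u v int

RainbowVertexConnected : ∀ {n k} → Graph n → (Fin n → Fin k) → Set
RainbowVertexConnected {n} G c =
  ∀ (u v : Fin n) → ¬ (u ≡ v) →
    ∃ λ int → IsPath G u v int × Unique (map c int)

RVC : ∀ {n} → Graph n → ℕ → Set
RVC {n} G k =
  (Σ (Fin n → Fin k) λ c → RainbowVertexConnected G c) ×
  (∀ j → j < k → ¬ (Σ (Fin n → Fin j) λ c → RainbowVertexConnected G c))

RVC≤ : ∀ {n} → Graph n → ℕ → Set
RVC≤ {n} G k = Σ (Fin n → Fin k) λ c → RainbowVertexConnected G c

-- G' : add a new vertex (index zero; old vertex i becomes suc i)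
-- adjacent exactly to the vertices of S.
addVertex : ∀ {n} → Graph n → Subset n → Graph (suc n)
addVertex {n} G S = record { adj = a ; sym = s ; irrfl = ir }
  where
  a : Fin (suc n) → Fin (suc n) → Bool
  a zero    zero    = false
  a zero    (suc j) = lookup S j
  a (suc i) zero    = lookup S i
  a (suc i) (suc j) = adj G i j
  s : ∀ x y → a x y ≡ a y x
  s zero    zero    = _≡_.refl
  s zero    (suc j) = _≡_.refl
  s (suc i) zero    = _≡_.refl
  s (suc i) (suc j) = sym G i j
  ir : ∀ x → a x x ≡ false
  ir zero    = _≡_.refl
  ir (suc i) = irrfl G i

-- Let T be the complement of S, so |T| ≤ k, and fix a rainbow k-colouring c of G. If every
-- t ∈ T ends one of the rainbow paths of c that pass through S, then c extended arbitrarily to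
-- the new vertex v works: v jumps onto such a path at a vertex of S. Otherwise some t₀ ∈ T is
-- joined to every vertex by a path with interior in T, so old vertices are joined through t₀
-- inside T. Choose e ∈ T such that every vertex of T is reached from S by a walk with interior
-- in T ∖ {e} (the tip of a maximal path grown in T away from S); colour T injectively and
-- S ∪ {v} like e. Finally S = ∅ is impossible: then n ≤ k, while the same choice of a
-- non-cut vertex gives rvc(G) ≤ n − 1.
module Submission where

open import Defs hiding (sym)
open import Data.Nat using (ℕ; zero; suc; _≤_; _<_; _∸_; _+_; s≤s; z≤n)
import Data.Nat.Properties as ℕ
open import Data.Fin using (Fin; zero; suc; punchOut; inject≤)
import Data.Fin as Fin
open import Data.Fin.Properties
  using (_≟_; any?; all?; ¬∀⟶∃¬; pigeonhole; suc-injective; punchOut-injective; inject≤-injective)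
open import Data.Fin.Subset using (Subset; ∣_∣; ∁)
open import Data.Fin.Subset.Properties using (∣∁p∣≡n∸∣p∣; nonempty?; Empty-unique; ∣⊥∣≡0)
open import Data.Bool using (true; false; T)
import Data.Bool.Properties as Bool
open import Data.Vec using (_∷_; lookup)
open import Data.Vec.Properties using ([]=⇒lookup)
import Data.Vec.Functional as Vector
open import Data.List using (List; []; _∷_; _++_; map; reverse; length)
import Data.List as List
open import Data.List.Properties using (++-assoc; unfold-reverse; reverse-++; reverse-map; map-++; map-∘)
open import Data.List.Relation.Unary.All using (All; []; _∷_)
import Data.List.Relation.Unary.All as All
import Data.List.Relation.Unary.All.Properties as All
open import Data.List.Relation.Unary.Any using (Any; here; there)
import Data.List.Relation.Unary.Any as Any
open import Data.List.Relation.Unary.AllPairs using ([]; _∷_)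
open import Data.List.Relation.Unary.Unique.Propositional using (Unique)
import Data.List.Relation.Unary.Unique.Propositional.Properties as Unique
open import Data.List.Membership.Propositional using (_∈_; _∉_; find)
open import Data.List.Membership.Propositional.Properties using (∈-∃++; ∈-++⁻; ∈-lookup; ∈-map⁻)
import Data.List.Membership.DecPropositional as DecMembership
open import Data.List.Relation.Binary.Subset.Propositional using (_⊆_)
open import Data.List.Relation.Binary.Subset.Propositional.Properties
  using (All-resp-⊇; ⊆-trans; ∷⁺ʳ; xs⊆x∷xs; xs⊆ys++xs)
open import Data.List.Relation.Binary.Permutation.Propositional using (↭-sym; ↭⇒↭ₛ)
open import Data.List.Relation.Binary.Permutation.Propositional.Properties using (↭-reverse; All-resp-↭)
import Data.List.Relation.Binary.Permutation.Setoid.Properties as Permutation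
open import Data.Product using (Σ; ∃; _×_; _,_; proj₁; proj₂)
open import Data.Sum using (_⊎_; inj₁; inj₂; [_,_])
open import Data.Unit using (tt)
open import Data.Empty using (⊥-elim)
open import Function using (_∘_)
open import Level using (0ℓ)
open import Relation.Nullary using (¬_; Dec; yes; no; ¬?)
open import Relation.Nullary.Decidable using (_×-dec_; _⊎-dec_; _→-dec_; T?; decidable-stable)
open import Relation.Unary using (Pred; Decidable)
open import Relation.Binary.PropositionalEquality
  using (_≡_; _≢_; refl; sym; trans; cong; subst; setoid; module ≡-Reasoning)

module _ {A : Set} where

  unique-∷ : ∀ {x : A} {xs} → x ∉ xs → Unique xs → Unique (x ∷ xs)
  unique-∷ x∉ u = All.tabulate (λ { y∈ refl → x∉ y∈ }) ∷ u

  unique-pair : ∀ {x y : A} → x ≢ y → Unique (x ∷ y ∷ [])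
  unique-pair x≢y = unique-∷ (λ { (here x≡y) → x≢y x≡y }) ([] ∷ [])

  unique-++⁻ʳ : ∀ xs {ys : List A} → Unique (xs ++ ys) → Unique ys
  unique-++⁻ʳ []       u       = u
  unique-++⁻ʳ (x ∷ xs) (_ ∷ u) = unique-++⁻ʳ xs u

  unique-++⁻ˡ : ∀ (xs : List A) {ys} → Unique (xs ++ ys) → Unique xs
  unique-++⁻ˡ []       _          = []
  unique-++⁻ˡ (x ∷ xs) (x≢ ∷ u) = All.++⁻ˡ xs x≢ ∷ unique-++⁻ˡ xs u

  unique-reverse : ∀ {xs : List A} → Unique xs → Unique (reverse xs)
  unique-reverse {xs} = Permutation.Unique-resp-↭ (setoid A) (↭⇒↭ₛ (↭-sym (↭-reverse xs)))

  all-reverse : ∀ {P : Pred A 0ℓ} {xs} → All P xs → All P (reverse xs)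
  all-reverse {xs = xs} = All-resp-↭ (↭-sym (↭-reverse xs))

  unique-map-injectiveOn : ∀ {B : Set} {P : Pred A 0ℓ} {f : A → B} →
    (∀ {x y} → P x → P y → f x ≡ f y → x ≡ y) →
    ∀ {xs} → All P xs → Unique xs → Unique (map f xs)
  unique-map-injectiveOn inj []         []         = []
  unique-map-injectiveOn inj (px ∷ pxs) (x≢ ∷ uxs) =
    All.map⁺ (All.zipWith (λ (py , x≢y) → x≢y ∘ inj px py) (pxs , x≢)) ∷
    unique-map-injectiveOn inj pxs uxs

  unique⇒lookup-injective : ∀ {xs : List A} → Unique xs →
    ∀ {i j} → i Fin.< j → List.lookup xs i ≢ List.lookup xs j
  unique⇒lookup-injective (x≢ ∷ _) {zero}  {suc j} _         = All.lookup x≢ (∈-lookup j)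
  unique⇒lookup-injective (_ ∷ u)  {suc i} {suc j} (s≤s i<j) = unique⇒lookup-injective u i<j

unique⇒length≤ : ∀ {n} {xs : List (Fin n)} → Unique xs → length xs ≤ n
unique⇒length≤ {n} {xs} u with length xs ℕ.≤? n
... | yes ≤n = ≤n
... | no ≰n with i , j , i<j , eq ← pigeonhole (ℕ.≰⇒> ≰n) (List.lookup xs) =
  ⊥-elim (unique⇒lookup-injective u i<j eq)

module _ {n : ℕ} (G : Graph n) where

  open DecMembership (_≟_ {n}) using (_∈?_)

  IsWalk : Fin n → Fin n → List (Fin n) → Set
  IsWalk u v int = Chain G (u ∷ int ++ v ∷ [])

  adj-sym : ∀ {x y} → T (adj G x y) → T (adj G y x)
  adj-sym {x} {y} = subst T (Graph.sym G x y)

  adj⇒≢ : ∀ {x y} → T (adj G x y) → x ≢ y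
  adj⇒≢ {x} a refl = subst T (irrfl G x) a

  walk-++ : ∀ u i₁ v i₂ w → IsWalk u v i₁ → IsWalk v w i₂ → IsWalk u w (i₁ ++ v ∷ i₂)
  walk-++ u []       v i₂ w (a , _)  c₂ = a , c₂
  walk-++ u (x ∷ i₁) v i₂ w (a , c₁) c₂ = a , walk-++ x i₁ v i₂ w c₁ c₂

  walk-reverse : ∀ u int v → IsWalk u v int → IsWalk v u (reverse int)
  walk-reverse u []        v (a , _) = adj-sym a , tt
  walk-reverse u (x ∷ int) v (a , c) rewrite unfold-reverse x int =
    walk-++ v (reverse int) x [] u (walk-reverse x int v c) (adj-sym a , tt)

  walk-suffix : ∀ u pre x post v → IsWalk u v (pre ++ x ∷ post) → IsWalk x v post
  walk-suffix u []        x post v (_ , c) = c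
  walk-suffix u (y ∷ pre) x post v (_ , c) = walk-suffix y pre x post v c

  path-reverse : ∀ u int v → IsPath G u v int → IsPath G v u (reverse int)
  path-reverse u int v (c , un) =
    walk-reverse u int v c , subst Unique reverse-vertices (unique-reverse un)
    where
    open ≡-Reasoning
    reverse-vertices : reverse (u ∷ int ++ v ∷ []) ≡ v ∷ reverse int ++ u ∷ []
    reverse-vertices = begin
      reverse (u ∷ int ++ v ∷ [])        ≡⟨ unfold-reverse u (int ++ v ∷ []) ⟩
      reverse (int ++ v ∷ []) ++ u ∷ []  ≡⟨ cong (_++ u ∷ []) (reverse-++ int (v ∷ [])) ⟩
      v ∷ reverse int ++ u ∷ []          ∎

  path⇒unique-interior : ∀ {u v int} → IsPath G u v int → Unique int
  path⇒unique-interior {int = int} (_ , _ ∷ un) = unique-++⁻ˡ int un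

  path-suffix : ∀ u pre x post v → IsPath G u v (pre ++ x ∷ post) → IsPath G x v post
  path-suffix u pre x post v (c , un) =
    walk-suffix u pre x post v c ,
    unique-++⁻ʳ (u ∷ pre) (subst Unique (cong (u ∷_) (++-assoc pre (x ∷ post) (v ∷ []))) un)

  path-prepend : ∀ u w int v → T (adj G u w) → u ≢ v → IsPath G w v int →
                 ∃ λ int′ → IsPath G u v int′ × int′ ⊆ w ∷ int
  path-prepend u w int v a u≢v (c , un) with u ∈? w ∷ int
  ... | yes (here refl) = int , (c , un) , xs⊆x∷xs int w
  ... | yes (there u∈) with pre , post , refl ← ∈-∃++ u∈ =
    post , path-suffix w pre u post v (c , un) ,
    ⊆-trans (xs⊆x∷xs post u) (xs⊆ys++xs (u ∷ post) (w ∷ pre))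
  ... | no u∉ = w ∷ int , ((a , c) , unique-∷ u∉′ un) , (λ y∈ → y∈)
    where
    u∉′ : u ∉ w ∷ int ++ v ∷ []
    u∉′ u∈ with ∈-++⁻ (w ∷ int) u∈
    ... | inj₁ u∈w∷int  = u∉ u∈w∷int
    ... | inj₂ (here u≡v) = u≢v u≡v

  walk⇒path : ∀ u int v → u ≢ v → IsWalk u v int →
              ∃ λ int′ → IsPath G u v int′ × int′ ⊆ int
  walk⇒path u []        v u≢v c = [] , (c , unique-pair u≢v) , λ ()
  walk⇒path u (w ∷ int) v u≢v (a , c) with w ≟ v
  ... | yes refl = [] , ((a , tt) , unique-pair u≢v) , λ ()
  ... | no w≢v with int′ , p , int′⊆int ← walk⇒path w int v w≢v c
                 with int″ , p′ , int″⊆ ← path-prepend u w int′ v a u≢v p =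
    int″ , p′ , ⊆-trans int″⊆ (∷⁺ʳ w int′⊆int)

  walk⇒path-All : ∀ {P : Pred (Fin n) 0ℓ} u v → u ≢ v →
                  ∃ (λ int → IsWalk u v int × All P int) →
                  ∃ λ int → IsPath G u v int × All P int
  walk⇒path-All u v u≢v (int , c , all)
    with int′ , p , int′⊆int ← walk⇒path u int v u≢v c = int′ , p , All-resp-⊇ int′⊆int all

  firstStep : ∀ {P : Pred (Fin n) 0ℓ} w post v → IsWalk w v post → All P post → P v →
              ∃ λ y → T (adj G w y) × P y
  firstStep w []       v (a , _) _        pv = v , a , pv
  firstStep w (y ∷ _)  v (a , _) (py ∷ _) _  = y , a , py

  FinalExit : Pred (Fin n) 0ℓ → Fin n → Set
  FinalExit Q v = ∃ λ w → Q w × ∃ λ post → IsWalk w v post × All (¬_ ∘ Q) post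

  module _ {Q : Pred (Fin n) 0ℓ} (Q? : Decidable Q) where

    private
      lastVisit : ∀ u int v → IsWalk u v int → All (¬_ ∘ Q) int ⊎ FinalExit Q v
      lastVisit u []        v _       = inj₁ []
      lastVisit u (w ∷ int) v (_ , c) with lastVisit w int v c | Q? w
      ... | inj₂ exit | _      = inj₂ exit
      ... | inj₁ none | yes qw = inj₂ (w , qw , int , c , none)
      ... | inj₁ none | no ¬qw = inj₁ (¬qw ∷ none)

    finalExit : ∀ u int v → Q u → IsWalk u v int → FinalExit Q v
    finalExit u int v qu c with lastVisit u int v c
    ... | inj₁ none = u , qu , int , c , none
    ... | inj₂ exit = exit

  hub-paths : ∀ {P : Pred (Fin n) 0ℓ} m → P m →
              (∀ z → z ≢ m → ∃ λ int → IsWalk z m int × All P int) →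
              ∀ a b → a ≢ b → ∃ λ int → IsPath G a b int × All P int
  hub-paths {P} m pm to-m a b a≢b = walk⇒path-All a b a≢b via-m
    where
    from-m : ∀ z → z ≢ m → ∃ λ int → IsWalk m z int × All P int
    from-m z z≢m with int , c , all ← to-m z z≢m =
      reverse int , walk-reverse z int m c , all-reverse all
    via-m : ∃ λ int → IsWalk a b int × All P int
    via-m with a ≟ m | b ≟ m
    ... | yes refl | _        = from-m b (a≢b ∘ sym)
    ... | no a≢m   | yes refl = to-m a a≢m
    ... | no a≢m   | no b≢m
        with i₁ , c₁ , all₁ ← to-m a a≢m | i₂ , c₂ , all₂ ← from-m b b≢m =
      i₁ ++ m ∷ i₂ , walk-++ a i₁ m i₂ b c₁ c₂ , All.++⁺ all₁ (pm ∷ all₂)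

  RainbowPath : ∀ {k} → (Fin n → Fin k) → Fin n → Fin n → List (Fin n) → Set
  RainbowPath c u v int = IsPath G u v int × Unique (map c int)

  rainbowPath-reverse : ∀ {k} {c : Fin n → Fin k} u int v →
                        RainbowPath c u v int → RainbowPath c v u (reverse int)
  rainbowPath-reverse {c = c} u int v (p , un) =
    path-reverse u int v p , subst Unique (sym (reverse-map c int)) (unique-reverse un)

  rainbowPath-injectiveOn : ∀ {k} {c : Fin n → Fin k} {P : Pred (Fin n) 0ℓ} →
    (∀ {x y} → P x → P y → c x ≡ c y → x ≡ y) →
    ∀ {u v int} → IsPath G u v int → All P int → RainbowPath c u v int
  rainbowPath-injectiveOn injective p all =
    p , unique-map-injectiveOn injective all (path⇒unique-interior p)

module NonCut {n : ℕ} (G : Graph n) (connected : Connected G)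
              {Root : Pred (Fin n) 0ℓ} (Root? : Decidable Root)
              (r₀ : Fin n) (root₀ : Root r₀) where

  open DecMembership (_≟_ {n}) using (_∈?_)

  NonRoot : Pred (Fin n) 0ℓ
  NonRoot x = ¬ Root x

  FromRoot : Pred (Fin n) 0ℓ → Fin n → Set
  FromRoot P a = ∃ λ r → Root r × ∃ λ int → IsWalk G r a int × All P int

  record Branch : Set where
    field
      tip     : Fin n
      trunk   : List (Fin n)
      unique  : Unique (tip ∷ trunk)
      nonRoot : All NonRoot (tip ∷ trunk)
      reached : ∀ {x} → x ∈ tip ∷ trunk → FromRoot (λ y → y ∈ tip ∷ trunk × y ≢ tip) x

  open Branch

  members : Branch → List (Fin n)
  members b = tip b ∷ trunk b

  Extension : Branch → Set
  Extension b = ∃ λ y → T (adj G (tip b) y) × NonRoot y × y ∉ members b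

  extension? : ∀ b → Dec (Extension b)
  extension? b = any? λ y → T? (adj G (tip b) y) ×-dec ¬? (Root? y) ×-dec ¬? (y ∈? members b)

  extend : (b : Branch) → Extension b → Branch
  extend b (y , tip-y , nonRoot-y , y∉) = record
    { tip     = y
    ; trunk   = members b
    ; unique  = unique-∷ y∉ (unique b)
    ; nonRoot = nonRoot-y ∷ nonRoot b
    ; reached = reached′
    }
    where
    old⇒new : ∀ {z} → z ∈ members b × z ≢ tip b → z ∈ y ∷ members b × z ≢ y
    old⇒new (z∈ , _) = there z∈ , λ { refl → y∉ z∈ }
    reached′ : ∀ {x} → x ∈ y ∷ members b → FromRoot (λ z → z ∈ y ∷ members b × z ≢ y) x
    reached′ (here refl) with r , root , int , c , all ← reached b (here refl) =
      r , root , int ++ tip b ∷ [] , walk-++ G r int (tip b) [] y c (tip-y , tt) ,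
      All.++⁺ (All.map old⇒new all) ((there (here refl) , adj⇒≢ G tip-y) ∷ [])
    reached′ (there x∈) with r , root , int , c , all ← reached b x∈ =
      r , root , int , c , All.map old⇒new all

  maximal : ∀ fuel (b : Branch) → n ≤ length (members b) + fuel → Σ Branch (¬_ ∘ Extension)
  maximal fuel b bound with extension? b
  ... | no ¬ext = b , ¬ext
  maximal zero b bound | yes ext =
    ⊥-elim (ℕ.<-irrefl refl (ℕ.<-≤-trans (unique⇒length≤ (unique (extend b ext)))
                                          (subst (n ≤_) (ℕ.+-identityʳ _) bound)))
  maximal (suc fuel) b bound | yes ext =
    maximal fuel (extend b ext) (subst (n ≤_) (ℕ.+-suc _ fuel) bound)

  Avoiding : Fin n → Pred (Fin n) 0ℓ
  Avoiding e y = NonRoot y × y ≢ e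

  member⇒avoiding : ∀ b {y} → y ∈ members b × y ≢ tip b → Avoiding (tip b) y
  member⇒avoiding b (y∈ , y≢tip) = All.lookup (nonRoot b) y∈ , y≢tip

  outside⇒avoiding : ∀ b {y} → ¬ (Root y ⊎ y ∈ members b) → Avoiding (tip b) y
  outside⇒avoiding b ¬q = ¬q ∘ inj₁ , ¬q ∘ inj₂ ∘ here

  maximal⇒nonCut : (b : Branch) → ¬ Extension b → ∀ a → NonRoot a → FromRoot (Avoiding (tip b)) a
  maximal⇒nonCut b ¬ext a nonRoot-a with a ∈? members b
  ... | yes a∈ with r , root , int , c , all ← reached b a∈ =
    r , root , int , c , All.map (member⇒avoiding b) all
  ... | no a∉
    with int₀ , c₀ , _ ← connected r₀ a (λ { refl → nonRoot-a root₀ })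
    with finalExit G (λ y → Root? y ⊎-dec (y ∈? members b)) r₀ int₀ a (inj₁ root₀) c₀
  ... | w , inj₁ root-w , post , c , outside =
    w , root-w , post , c , All.map (outside⇒avoiding b) outside
  ... | w , inj₂ w∈ , post , c , outside
    with r , root , int , c′ , all ← reached b w∈ =
    r , root , int ++ w ∷ post , walk-++ G r int w post a c′ c ,
    All.++⁺ (All.map (member⇒avoiding b) all)
            (member⇒avoiding b (w∈ , w≢tip) ∷ All.map (outside⇒avoiding b) outside)
    where
    -- at the tip, the final exit would extend the branch
    w≢tip : w ≢ tip b
    w≢tip refl with y , tip-y , ¬q ← firstStep G w post a c outside [ nonRoot-a , a∉ ] =
      ¬ext (y , tip-y , ¬q ∘ inj₁ , ¬q ∘ inj₂)

  seed : ∀ {w y} → Root w → T (adj G w y) → NonRoot y → Branch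
  seed {w} {y} root-w w-y nonRoot-y = record
    { tip     = y
    ; trunk   = []
    ; unique  = [] ∷ []
    ; nonRoot = nonRoot-y ∷ []
    ; reached = λ { (here refl) → w , root-w , [] , (w-y , tt) , [] }
    }

  nonCutVertex : ∀ a₀ → NonRoot a₀ →
                 ∃ λ e → NonRoot e × ∀ a → NonRoot a → FromRoot (Avoiding e) a
  nonCutVertex a₀ nonRoot-a₀
    with int₀ , c₀ , _ ← connected r₀ a₀ (λ { refl → nonRoot-a₀ root₀ })
    with w , root-w , post , c , nonRoots ← finalExit G Root? r₀ int₀ a₀ root₀ c₀
    with y , w-y , nonRoot-y ← firstStep G w post a₀ c nonRoots nonRoot-a₀
    with b , ¬ext ← maximal n (seed root-w w-y nonRoot-y) (ℕ.n≤1+n n) =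
    tip b , All.head (nonRoot b) , maximal⇒nonCut b ¬ext

rvc≤n∸1 : ∀ {n} (G : Graph n) → 2 ≤ n → Connected G → RVC≤ G (n ∸ 1)
rvc≤n∸1 {suc zero} G (s≤s ()) connected
rvc≤n∸1 {suc (suc m)} G _ connected
  with e , e≢0 , reach ← NonCut.nonCutVertex G connected (_≟ zero) zero refl (suc zero) (λ ()) =
  colour , rainbow
  where
  colour : Fin (suc (suc m)) → Fin (suc m)
  colour x with e ≟ x
  ... | yes _   = zero  -- e is never interior to the paths below
  ... | no e≢x  = punchOut e≢x

  colour-injective : ∀ {x y} → x ≢ e → y ≢ e → colour x ≡ colour y → x ≡ y
  colour-injective {x} {y} x≢e y≢e eq with e ≟ x | e ≟ y
  ... | yes e≡x | _       = ⊥-elim (x≢e (sym e≡x))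
  ... | no _    | yes e≡y = ⊥-elim (y≢e (sym e≡y))
  ... | no e≢x  | no e≢y  = punchOut-injective e≢x e≢y eq

  to-zero : ∀ z → z ≢ zero → ∃ λ int → IsWalk G z zero int × All (_≢ e) int
  to-zero z z≢0 with _ , refl , int , c , avoid ← reach z z≢0 =
    reverse int , walk-reverse G zero int z c , all-reverse (All.map proj₂ avoid)

  rainbow : RainbowVertexConnected G colour
  rainbow a b a≢b with int , p , avoid ← hub-paths G zero (e≢0 ∘ sym) to-zero a b a≢b =
    int , rainbowPath-injectiveOn G colour-injective p avoid

Inside Outside : ∀ {m} → Subset m → Fin m → Set
Inside  p x = lookup p x ≡ true
Outside p x = lookup p x ≡ false

outsideRank : ∀ {m} (p : Subset m) x → .(Outside p x) → Fin ∣ ∁ p ∣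
outsideRank (false ∷ p) zero    _ = zero
outsideRank (false ∷ p) (suc x) o = suc (outsideRank p x o)
outsideRank (true  ∷ p) (suc x) o = outsideRank p x o

outsideRank-injective : ∀ {m} (p : Subset m) x y .ox .oy →
                        outsideRank p x ox ≡ outsideRank p y oy → x ≡ y
outsideRank-injective (false ∷ p) zero    zero    _  _  _  = refl
outsideRank-injective (false ∷ p) (suc x) (suc y) ox oy eq =
  cong suc (outsideRank-injective p x y ox oy (suc-injective eq))
outsideRank-injective (true  ∷ p) (suc x) (suc y) ox oy eq =
  cong suc (outsideRank-injective p x y ox oy eq)

complementColouring : ∀ {m k} (p : Subset m) → ∣ ∁ p ∣ ≤ k → ∀ e → Outside p e →
  Σ (Fin m → Fin k) λ colour →
    (∀ {x y} → Outside p x → Outside p y → colour x ≡ colour y → x ≡ y) ×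
    (∀ {x} → Inside p x → colour x ≡ colour e)
complementColouring {m} {k} p bound e outside-e = colour , colour-injective , colour-inside
  where
  index : ∀ x → .(Outside p x) → Fin k
  index x o = inject≤ (outsideRank p x o) bound

  colourBy : ∀ x b → lookup p x ≡ b → Fin k
  colourBy x true  _ = index e outside-e
  colourBy x false o = index x o

  colour : Fin m → Fin k
  colour x = colourBy x (lookup p x) refl

  colourBy-outside : ∀ {x} b (eq : lookup p x ≡ b) (o : Outside p x) → colourBy x b eq ≡ index x o
  colourBy-outside true  eq o with () ← trans (sym eq) o
  colourBy-outside false eq o = refl

  colourBy-inside : ∀ {x} b (eq : lookup p x ≡ b) → Inside p x → colourBy x b eq ≡ colour e
  colourBy-inside true  eq i = sym (colourBy-outside _ refl outside-e)
  colourBy-inside false eq i with () ← trans (sym eq) i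

  colour-inside : ∀ {x} → Inside p x → colour x ≡ colour e
  colour-inside = colourBy-inside _ refl

  colour-injective : ∀ {x y} → Outside p x → Outside p y → colour x ≡ colour y → x ≡ y
  colour-injective {x} {y} ox oy eq =
    outsideRank-injective p x y ox oy (inject≤-injective bound bound _ _ (begin
      index x ox   ≡⟨ colourBy-outside _ refl ox ⟨
      colour x     ≡⟨ eq ⟩
      colour y     ≡⟨ colourBy-outside _ refl oy ⟩
      index y oy   ∎))
    where open ≡-Reasoning

module _ {n : ℕ} (G : Graph n) (S : Subset n) where

  private
    G′ = addVertex G S

  lift-chain : ∀ xs → Chain G xs → Chain G′ (map suc xs)
  lift-chain []           _       = tt
  lift-chain (x ∷ [])     _       = tt
  lift-chain (x ∷ y ∷ xs) (a , c) = a , lift-chain (y ∷ xs) c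

  map-suc-vertices : ∀ (u : Fin n) int v →
                     map suc (u ∷ int ++ v ∷ []) ≡ suc u ∷ map suc int ++ suc v ∷ []
  map-suc-vertices u int v = cong (suc u ∷_) (map-++ suc int (v ∷ []))

  lift-path : ∀ u int v → IsPath G u v int → IsPath G′ (suc u) (suc v) (map suc int)
  lift-path u int v (c , un) =
    subst (Chain G′) (map-suc-vertices u int v) (lift-chain _ c) ,
    subst Unique (map-suc-vertices u int v) (Unique.map⁺ suc-injective un)

  zero∉map-suc : ∀ (xs : List (Fin n)) → Fin.zero ∉ map Fin.suc xs
  zero∉map-suc xs zero∈ with _ , _ , () ← ∈-map⁻ suc zero∈

  module _ {k : ℕ} (d : Fin (suc n) → Fin k) where

    lift-rainbowPath : ∀ u int v → RainbowPath G (d ∘ suc) u v int →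
                       RainbowPath G′ d (suc u) (suc v) (map suc int)
    lift-rainbowPath u int v (p , un) =
      lift-path u int v p , subst Unique (map-∘ int) un

    edge-fromNew : ∀ v → Inside S v → RainbowPath G′ d zero (suc v) []
    edge-fromNew v inside = ((subst T (sym inside) tt , tt) , unique-pair (λ ())) , []

    path-fromNew : ∀ s int v → Inside S s → IsPath G s v int → Unique (map (d ∘ suc) (s ∷ int)) →
                   RainbowPath G′ d zero (suc v) (suc s ∷ map suc int)
    path-fromNew s int v inside p un with c , un′ ← lift-path s int v p =
      ((subst T (sym inside) tt , c) , unique-∷ zero∉ un′) , subst Unique (map-∘ (s ∷ int)) un
      where
      zero∉ : Fin.zero ∉ suc s ∷ map suc int ++ suc v ∷ []
      zero∉ = zero∉map-suc (s ∷ int ++ v ∷ []) ∘ subst (zero ∈_) (sym (map-suc-vertices s int v))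

    rainbow-addVertex : (∀ v → ∃ (RainbowPath G′ d zero (suc v))) →
                        RainbowVertexConnected G (d ∘ suc) →
                        RainbowVertexConnected G′ d
    rainbow-addVertex fromNew rainbow zero    zero    0≢0 = ⊥-elim (0≢0 refl)
    rainbow-addVertex fromNew rainbow zero    (suc v) _   = fromNew v
    rainbow-addVertex fromNew rainbow (suc u) zero    _
      with int , rp ← fromNew u = _ , rainbowPath-reverse G′ zero int (suc u) rp
    rainbow-addVertex fromNew rainbow (suc u) (suc v) u≢v
      with int , rp ← rainbow u v (u≢v ∘ cong suc) = _ , lift-rainbowPath u int v rp

  rvc≤-byExtension : ∀ {k} (c : Fin n → Fin k) (c₀ : Fin k) → RainbowVertexConnected G c →
    (∀ v → Outside S v → ∃ λ z → ∃ λ int → RainbowPath G c z v int × Any (Inside S) int) →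
    RVC≤ G′ k
  rvc≤-byExtension {k} c c₀ rainbow meetsS = d , rainbow-addVertex d fromNew rainbow
    where
    d : Fin (suc n) → Fin k
    d = c₀ Vector.∷ c

    fromNew : ∀ v → ∃ (RainbowPath G′ d zero (suc v))
    fromNew v with lookup S v in o
    ... | true = [] , edge-fromNew d v o
    ... | false with z , int , (p , un) , meets ← meetsS v o
                with s , s∈ , inside ← find meets
                with pre , post , refl ← ∈-∃++ s∈ =
      _ , path-fromNew d s post v inside (path-suffix G z pre s post v p)
            (unique-++⁻ʳ (map c pre) (subst Unique (map-++ c pre (s ∷ post)) un))

  rvc≤-byOutsideHub : ∀ {k} → Connected G → ∣ ∁ S ∣ ≤ k →
    ∀ r₀ → Inside S r₀ → ∀ t₀ → Outside S t₀ →
    (∀ z → z ≢ t₀ → ∃ λ int → IsWalk G z t₀ int × All (Outside S) int) →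
    RVC≤ G′ k
  rvc≤-byOutsideHub {k} connected bound r₀ inside-r₀ t₀ outside-t₀ to-t₀
    with e , ¬inside-e , reach ← NonCut.nonCutVertex G connected (λ x → lookup S x Bool.≟ true)
                                   r₀ inside-r₀ t₀ (Bool.not-¬ outside-t₀)
    with colour , colour-injective , colour-inside ←
           complementColouring S bound e (Bool.¬-not ¬inside-e) =
    d , rainbow-addVertex d fromNew rainbow
    where
    d : Fin (suc n) → Fin k
    d = colour e Vector.∷ colour

    fromNew : ∀ v → ∃ (RainbowPath G′ d zero (suc v))
    fromNew v with lookup S v in o
    ... | true = [] , edge-fromNew d v o
    ... | false with r , inside-r , int , c , avoid ← reach v (Bool.not-¬ o)
                with int′ , p , avoid′ ← walk⇒path-All G r v (λ { refl → Bool.not-¬ o inside-r })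
                                                       (int , c , avoid) =
      _ , path-fromNew d r int′ v inside-r p (unique-∷ colour-r∉ colours-unique)
      where
      outside : All (Outside S) int′
      outside = All.map (Bool.¬-not ∘ proj₁) avoid′
      colours-unique : Unique (map colour int′)
      colours-unique = proj₂ (rainbowPath-injectiveOn G colour-injective p outside)
      colour-r∉ : colour r ∉ map colour int′
      colour-r∉ r∈ with y , y∈ , eq ← ∈-map⁻ colour r∈ =
        proj₂ (All.lookup avoid′ y∈)
          (sym (colour-injective (Bool.¬-not ¬inside-e) (All.lookup outside y∈)
                                 (trans (sym (colour-inside inside-r)) eq)))

    rainbow : RainbowVertexConnected G colour
    rainbow a b a≢b with int , p , outside ← hub-paths G t₀ outside-t₀ to-t₀ a b a≢b =
      int , rainbowPath-injectiveOn G colour-injective p outside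

module _ {n k : ℕ} (G : Graph n) (S : Subset n) {c : Fin n → Fin k}
         (rainbow : RainbowVertexConnected G c) where

  private
    chosenPath : Fin n → Fin n → List (Fin n)
    chosenPath z v with z ≟ v
    ... | yes _   = []
    ... | no z≢v  = proj₁ (rainbow z v z≢v)

    chosenPath-rainbow : ∀ {z v} → z ≢ v → RainbowPath G c z v (chosenPath z v)
    chosenPath-rainbow {z} {v} z≢v with z ≟ v
    ... | yes z≡v  = ⊥-elim (z≢v z≡v)
    ... | no z≢v′  = proj₂ (rainbow z v z≢v′)

    ReachedThroughS : Fin n → Set
    ReachedThroughS v = ∃ λ z → z ≢ v × Any (Inside S) (chosenPath z v)

    reachedThroughS? : ∀ v → Dec (ReachedThroughS v)
    reachedThroughS? v =
      any? λ z → ¬? (z ≟ v) ×-dec Any.any? (λ y → lookup S y Bool.≟ true) (chosenPath z v)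

    OutsideReachedThroughS : Fin n → Set
    OutsideReachedThroughS v = Outside S v → ReachedThroughS v

    outsideReachedThroughS? : ∀ v → Dec (OutsideReachedThroughS v)
    outsideReachedThroughS? v = (lookup S v Bool.≟ false) →-dec reachedThroughS? v

  rainbowPaths-meetS-or-avoidS :
    (∀ v → Outside S v → ∃ λ z → ∃ λ int → RainbowPath G c z v int × Any (Inside S) int) ⊎
    (∃ λ t₀ → Outside S t₀ × ∀ z → z ≢ t₀ → ∃ λ int → IsWalk G z t₀ int × All (Outside S) int)
  rainbowPaths-meetS-or-avoidS with all? outsideReachedThroughS?
  ... | yes reached = inj₁ λ v o →
    let z , z≢v , meets = reached v o in z , chosenPath z v , chosenPath-rainbow z≢v , meets
  ... | no ¬reached
    with t₀ , ¬reached-t₀ ← ¬∀⟶∃¬ n OutsideReachedThroughS outsideReachedThroughS? ¬reached =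
    inj₂ (t₀ , outside-t₀ , avoids)
    where
    outside-t₀ : Outside S t₀
    outside-t₀ = decidable-stable (lookup S t₀ Bool.≟ false) λ ¬o → ¬reached-t₀ (⊥-elim ∘ ¬o)
    avoids : ∀ z → z ≢ t₀ → ∃ λ int → IsWalk G z t₀ int × All (Outside S) int
    avoids z z≢t₀ = chosenPath z t₀ , proj₁ (proj₁ (chosenPath-rainbow z≢t₀)) ,
      All.map Bool.¬-not (All.¬Any⇒All¬ _ λ meets → ¬reached-t₀ λ _ → z , z≢t₀ , meets)

m∸n≤o⇒m∸o≤n : ∀ m n o → m ∸ n ≤ o → m ∸ o ≤ n
m∸n≤o⇒m∸o≤n m n o m∸n≤o = ℕ.m≤n+o⇒m∸n≤o m o (begin
  m           ≤⟨ ℕ.m≤n+m∸n m n ⟩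
  n + (m ∸ n) ≤⟨ ℕ.+-monoʳ-≤ n m∸n≤o ⟩
  n + o       ≡⟨ ℕ.+-comm n o ⟩
  o + n       ∎)
  where open ℕ.≤-Reasoning

lemma2p1 : ∀ (n k q : ℕ) (G : Graph n) (S : Subset n) →
    2 ≤ n → Connected G → RVC G k →
    ∣ S ∣ ≡ q → n ∸ k ≤ q →
    RVC≤ (addVertex G S) k
lemma2p1 n k q G S 2≤n connected ((c , rainbow) , minimal) ∣S∣≡q n∸k≤q with nonempty? S
... | no empty = ⊥-elim (minimal (n ∸ 1) n∸1<k (rvc≤n∸1 G 2≤n connected))
  where
  q≡0 : q ≡ 0
  q≡0 = trans (sym ∣S∣≡q) (trans (cong ∣_∣ (Empty-unique empty)) (∣⊥∣≡0 n))
  n≤k : n ≤ k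
  n≤k = ℕ.m∸n≡0⇒m≤n (ℕ.n≤0⇒n≡0 (subst (n ∸ k ≤_) q≡0 n∸k≤q))
  n∸1<k : n ∸ 1 < k
  n∸1<k = ℕ.<-≤-trans (ℕ.∸-monoʳ-< (s≤s z≤n) (ℕ.≤-trans (ℕ.n≤1+n 1) 2≤n)) n≤k
... | yes (r₀ , r₀∈S) with rainbowPaths-meetS-or-avoidS G S rainbow
...   | inj₁ meetS = rvc≤-byExtension G S c (c r₀) rainbow meetS
...   | inj₂ (t₀ , outside-t₀ , avoidS) =
  rvc≤-byOutsideHub G S connected ∣∁S∣≤k r₀ ([]=⇒lookup r₀∈S) t₀ outside-t₀ avoidS
  where
  ∣∁S∣≤k : ∣ ∁ S ∣ ≤ k
  ∣∁S∣≤k = subst (_≤ k) (sym (trans (∣∁p∣≡n∸∣p∣ S) (cong (n ∸_) ∣S∣≡q)))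
                 (m∸n≤o⇒m∸o≤n n k q n∸k≤q)
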